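{- Let $G$ be a connected planar graph with minimum degree $\delta(G)\geq 3$ and girth $g(G)\geq 4$. Then $G$ contains at least one of the following: (a) an edge $uv$ with $d(u)=3$ and $d(v)\leq 4$; (b) a vertex $v$ with $d(v)=5$ having at least $4$ neighbors of degree $3$.
   Context: $d(v)$ denotes the degree of $v$; the girth $g(G)$ is the length of a shortest cycle in $G$. -}

module Defs where

open import Data.Nat using (ℕ; zero; suc; _+_; _*_; _≤_; _<_; _≟_)
open import Data.Bool using (Bool; true; false; if_then_else_)
open import Data.Fin using (Fin; zero; suc; inject₁; fromℕ)
open import Data.Product using (Σ; ∃; _×_; _,_)
open import Data.Sum using (_⊎_)
open import Relation.Nullary using (¬_; does)
open import Relation.Binary.PropositionalEquality using (_≡_)

record Graph : Set where
  field
    n     : ℕ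
    adj   : Fin n → Fin n → Bool
    sym   : ∀ u v → adj u v ≡ adj v u
    irrefl : ∀ v → adj v v ≡ false
open Graph public

Adj : (G : Graph) → Fin (n G) → Fin (n G) → Set
Adj G u v = adj G u v ≡ true

count : ∀ {k} → (Fin k → Bool) → ℕ
count {zero}  p = 0
count {suc k} p = (if p zero then 1 else 0) + count (λ i → p (suc i))

deg : (G : Graph) → Fin (n G) → ℕ
deg G v = count (adj G v)

minDegree≥ : Graph → ℕ → Set
minDegree≥ G d = ∀ v → d ≤ deg G v

data Walk (G : Graph) : Fin (n G) → Fin (n G) → Set where
  here : ∀ {v} → Walk G v v
  step : ∀ {u v w} → Adj G u v → Walk G v w → Walk G u w

Connected : Graph → Set
Connected G = (0 < n G) × (∀ u v → Walk G u v)

record Cycle (G : Graph) (len : ℕ) : Set where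
  field
    m       : ℕ
    len≡    : len ≡ suc m
    len≥3   : 3 ≤ suc m
    c       : Fin (suc m) → Fin (n G)
    inj     : ∀ i j → c i ≡ c j → i ≡ j
    consec  : ∀ (i : Fin m) → Adj G (c (inject₁ i)) (c (suc i))
    closing : Adj G (c (fromℕ m)) (c zero)

girth≥ : Graph → ℕ → Set
girth≥ G k = ∀ len → Cycle G len → k ≤ len

iter : ∀ {A : Set} → (A → A) → ℕ → A → A
iter f zero    x = x
iter f (suc k) x = f (iter f k x)

sumFin : ∀ {k} → (Fin k → ℕ) → ℕ
sumFin {zero}  f = 0
sumFin {suc k} f = f zero + sumFin (λ i → f (suc i))

-- number of darts (ordered pairs (u,v) with uv ∈ E) = Σ_v d(v) = 2 |E(G)|
dartCount : Graph → ℕ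
dartCount G = sumFin (deg G)

-- A rotation system: for each vertex v, rot v restricted to the neighbourhood
-- N(v) is a cyclic permutation of N(v) (rot v u = neighbour following u
-- in the clockwise order around v).
record RotationSystem (G : Graph) : Set where
  field
    rot      : Fin (n G) → Fin (n G) → Fin (n G)
    closed   : ∀ v u → Adj G v u → Adj G v (rot v u)
    injN     : ∀ v u w → Adj G v u → Adj G v w → rot v u ≡ rot v w → u ≡ w
    cyclic   : ∀ v u w → Adj G v u → Adj G v w → ∃ λ k → iter (rot v) k u ≡ w

  -- face-tracing permutation on darts: (u , v) ↦ (v , rot v u)
  φ : Fin (n G) × Fin (n G) → Fin (n G) × Fin (n G)
  φ (u , v) = (v , rot v u)
open RotationSystem public

-- The faces of a rotation system: a surjective labelling of the darts by
-- Fin f whose fibres are exactly the φ-orbits; f is then the number of faces.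
record Faces (G : Graph) (R : RotationSystem G) (f : ℕ) : Set where
  field
    face    : Fin (n G) → Fin (n G) → Fin f
    orbit→  : ∀ u v u' v' → Adj G u v → Adj G u' v' →
              face u v ≡ face u' v' → ∃ λ k → iter (φ R) k (u , v) ≡ (u' , v')
    →orbit  : ∀ u v u' v' → Adj G u v → Adj G u' v' →
              (∃ λ k → iter (φ R) k (u , v) ≡ (u' , v')) → face u v ≡ face u' v'
    surj    : ∀ (i : Fin f) → ∃ λ u → ∃ λ v → Adj G u v × (face u v ≡ i)

-- Planarity (for connected graphs), combinatorially: the graph is edgeless,
-- or it has a rotation system (combinatorial embedding) of genus 0, i.e.
-- with  |V| − |E| + |F| = 2 , written as 2(|V| + |F|) = 2|E| + 4.
Planar : Graph → Set
Planar G = (dartCount G ≡ 0) ⊎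
  (Σ (RotationSystem G) λ R → ∃ λ f → Faces G R f × (2 * (n G + f) ≡ dartCount G + 4))

deg3Neighbours : (G : Graph) → Fin (n G) → ℕ
deg3Neighbours G v = count (λ u → if adj G v u then does (deg G u ≟ 3) else false)

-- Suppose neither configuration occurs.  Charge every vertex v with d(v) − 4 and let each
-- vertex send 1/3 to every neighbour of degree 3.  A 3-vertex has only neighbours of degree
-- at least 5 and ends with charge 0, a 4-vertex has no neighbour of degree 3, a 5-vertex has
-- at most three, and a d-vertex with d ≥ 6 keeps at least 2d/3 − 4 ≥ 0.  Hence 4|V| ≤ 2|E|.
-- On the other hand, in a genus-0 rotation system every face is traced by at least four
-- darts with distinct tails (the face walk cannot turn back as degrees are at least 2, and
-- cannot close after three steps as there are no triangles), so 4|F| ≤ 2|E|, and Euler's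
-- formula gives 2|E| + 8 ≤ 4|V|.

{-# OPTIONS --safe #-}
module Submission where

open import Defs hiding (sym)
open import Data.Nat using (ℕ; zero; suc; _+_; _*_; _≤_; _<_; _≟_; _≤?_; z≤n; s≤s)
open import Data.Nat.Properties
  using (≤-refl; ≤-trans; ≤-reflexive; <⇒≤; ≤-pred; ≰⇒>; 1+n≰n; m+1+n≰m; n≤1+n; m≤m+n; m≤m*n;
         +-comm; +-identityʳ; +-mono-≤; +-monoʳ-≤; +-cancelʳ-≤; +-cancelˡ-≤; *-zeroʳ; *-cancelˡ-≤; *-monoʳ-≤;
         +-*-semiring; module ≤-Reasoning)
open import Algebra.Properties.Semiring.Sum +-*-semiring
  using (sum-syntax; ∑-comm; ∑-distrib-+; sum-cong-≗; *-distribˡ-sum; *-distribʳ-sum; sum-replicate-zero)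
open import Data.Nat.Tactic.RingSolver using (solve-∀)
open import Data.Bool using (Bool; true; false; if_then_else_; _∧_)
open import Data.Bool.Properties using () renaming (_≟_ to _≟ᴮ_)
open import Data.Fin using (Fin; zero; suc; inject₁)
open import Data.Fin.Patterns using (0F; 1F; 2F)
open import Data.Fin.Properties using (any?) renaming (_≟_ to _≟ᶠ_)
open import Data.Fin.Subset using (Subset; _∈_; ∣_∣; _-_)
open import Data.Fin.Subset.Properties using (x∈p∧x≢y⇒x∈p-y; x∈p⇒∣p-x∣<∣p∣; p⊆q⇒∣p∣≤∣q∣)
open import Data.Vec using (tabulate)
open import Data.Vec.Properties using (lookup∘tabulate; lookup⇒[]=; []=⇒lookup)
open import Data.List using (List; []; _∷_; length)
open import Data.List.Relation.Unary.All as All using (All; []; _∷_)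
open import Data.List.Relation.Unary.AllPairs using ([]; _∷_)
open import Data.List.Relation.Unary.Unique.Propositional using (Unique)
open import Data.Product using (∃; _×_; _,_; proj₁; proj₂; uncurry)
open import Data.Sum using (_⊎_; inj₁; inj₂)
open import Data.Empty using (⊥; ⊥-elim)
open import Function using (_∘_)
open import Relation.Nullary using (¬_; Dec; yes; no; does)
open import Relation.Nullary.Decidable using (_×-dec_; dec-true)
open import Relation.Binary.PropositionalEquality using (_≡_; _≢_; refl; sym; trans; cong; cong₂; subst; subst₂; ≢-sym; module ≡-Reasoning)

𝟙 : Bool → ℕ
𝟙 b = if b then 1 else 0

sumFin≡∑ : ∀ {k} (f : Fin k → ℕ) → sumFin f ≡ ∑[ i < k ] f i
sumFin≡∑ {zero}  f = refl
sumFin≡∑ {suc k} f = cong (f zero +_) (sumFin≡∑ (f ∘ suc))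

∑-const : ∀ k c → ∑[ i < k ] c ≡ k * c
∑-const zero    c = refl
∑-const (suc k) c = cong (c +_) (∑-const k c)

∑-mono-≤ : ∀ {k} {f g : Fin k → ℕ} → (∀ i → f i ≤ g i) → ∑[ i < k ] f i ≤ ∑[ i < k ] g i
∑-mono-≤ {zero}  f≤g = z≤n
∑-mono-≤ {suc k} f≤g = +-mono-≤ (f≤g zero) (∑-mono-≤ (f≤g ∘ suc))

count≡∑ : ∀ {k} (p : Fin k → Bool) → count p ≡ ∑[ i < k ] 𝟙 (p i)
count≡∑ {zero}  p = refl
count≡∑ {suc k} p = cong (𝟙 (p zero) +_) (count≡∑ (p ∘ suc))

count≡∣tabulate∣ : ∀ {k} (p : Fin k → Bool) → count p ≡ ∣ tabulate p ∣
count≡∣tabulate∣ {zero}  p = refl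
count≡∣tabulate∣ {suc k} p with p zero
... | true  = cong suc (count≡∣tabulate∣ (p ∘ suc))
... | false = count≡∣tabulate∣ (p ∘ suc)

∈-tabulate⁺ : ∀ {k} {p : Fin k → Bool} {x} → p x ≡ true → x ∈ tabulate p
∈-tabulate⁺ {p = p} {x} px = lookup⇒[]= x (tabulate p) (trans (lookup∘tabulate p x) px)

∈-tabulate⁻ : ∀ {k} {p : Fin k → Bool} {x} → x ∈ tabulate p → p x ≡ true
∈-tabulate⁻ {p = p} {x} x∈p = trans (sym (lookup∘tabulate p x)) ([]=⇒lookup x∈p)

length≤∣∣ : ∀ {k} {s : Subset k} {xs : List (Fin k)} → Unique xs → All (_∈ s) xs → length xs ≤ ∣ s ∣
length≤∣∣ [] [] = z≤n
length≤∣∣ {s = s} {x ∷ xs} (x∉xs ∷ xs-unique) (x∈s ∷ xs⊆s) =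
  ≤-trans (s≤s (length≤∣∣ xs-unique xs⊆s-x)) (x∈p⇒∣p-x∣<∣p∣ x∈s)
  where
  xs⊆s-x : All (_∈ s - x) xs
  xs⊆s-x = All.zipWith (λ (y∈s , x≢y) → x∈p∧x≢y⇒x∈p-y y∈s (≢-sym x≢y)) (xs⊆s , x∉xs)

length≤count : ∀ {k} {p : Fin k → Bool} {xs : List (Fin k)} →
               Unique xs → All (λ x → p x ≡ true) xs → length xs ≤ count p
length≤count {p = p} xs-unique pxs =
  subst (_ ≤_) (sym (count≡∣tabulate∣ p)) (length≤∣∣ xs-unique (All.map ∈-tabulate⁺ pxs))

1≤count : ∀ {k} {p : Fin k → Bool} {x} → p x ≡ true → 1 ≤ count p
1≤count {p = p} px = length≤count {p = p} ([] ∷ []) (px ∷ [])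

count-mono : ∀ {k} {p q : Fin k → Bool} → (∀ x → p x ≡ true → q x ≡ true) → count p ≤ count q
count-mono {p = p} {q} p⇒q = subst₂ _≤_ (sym (count≡∣tabulate∣ p)) (sym (count≡∣tabulate∣ q))
  (p⊆q⇒∣p∣≤∣q∣ (∈-tabulate⁺ {p = q} ∘ p⇒q _ ∘ ∈-tabulate⁻ {p = p}))

count-none : ∀ {k} {p : Fin k → Bool} → (∀ x → p x ≢ true) → count p ≡ 0
count-none {zero}          _  = refl
count-none {suc k} {p} ¬p with p zero in p0
... | true  = ⊥-elim (¬p zero p0)
... | false = count-none (¬p ∘ suc)

count-≟ : ∀ {k} (a : Fin k) → count (λ x → does (a ≟ᶠ x)) ≡ 1
count-≟ {suc k} zero = cong suc (count-none {k} (λ _ ()))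
count-≟ (suc a)      = count-≟ a

count≤1 : ∀ {k} {p : Fin k → Bool} (a : Fin k) → (∀ x → p x ≡ true → x ≡ a) → count p ≤ 1
count≤1 {p = p} a p⇒≡a =
  subst (_ ≤_) (count-≟ a) (count-mono {p = p} (λ x px → dec-true (a ≟ᶠ x) (sym (p⇒≡a x px))))

length≤∑ : ∀ {k} {c : Fin k → ℕ} {xs : List (Fin k)} →
           Unique xs → All (λ x → 1 ≤ c x) xs → length xs ≤ ∑[ x < k ] c x
length≤∑ {k} {c} {xs} xs-unique c>0 = begin
  length xs                        ≤⟨ length≤count {p = c>0?} xs-unique (All.map (dec-true (1 ≤? _)) c>0) ⟩
  count c>0?                       ≡⟨ count≡∑ c>0? ⟩
  ∑[ x < k ] 𝟙 (c>0? x)            ≤⟨ ∑-mono-≤ (λ x → 𝟙[1≤?m]≤m (c x)) ⟩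
  ∑[ x < k ] c x                   ∎
  where
  open ≤-Reasoning
  c>0? : Fin k → Bool
  c>0? x = does (1 ≤? c x)
  𝟙[1≤?m]≤m : ∀ m → 𝟙 (does (1 ≤? m)) ≤ m
  𝟙[1≤?m]≤m zero    = z≤n
  𝟙[1≤?m]≤m (suc m) = s≤s z≤n

count-∧-≟ : ∀ {k} (b : Bool) (a : Fin k) → count (λ x → b ∧ does (a ≟ᶠ x)) ≡ 𝟙 b
count-∧-≟     true  a = count-≟ a
count-∧-≟ {k} false a = count-none {k} (λ _ ())

count-fibres : ∀ {k f} (p : Fin k → Bool) (ℓ : Fin k → Fin f) →
               count p ≡ ∑[ i < f ] count (λ x → p x ∧ does (ℓ x ≟ᶠ i))
count-fibres {zero}  {f} p ℓ = sym (sum-replicate-zero f)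
count-fibres {suc k} {f} p ℓ = begin
  𝟙 (p zero) + count (p ∘ suc)
    ≡⟨ cong₂ _+_ (sym (count-∧-≟ (p zero) (ℓ zero))) (count-fibres (p ∘ suc) (ℓ ∘ suc)) ⟩
  count at0 + ∑[ i < f ] count (atSuc i)
    ≡⟨ cong (_+ ∑[ i < f ] count (atSuc i)) (count≡∑ at0) ⟩
  ∑[ i < f ] 𝟙 (at0 i) + ∑[ i < f ] count (atSuc i)
    ≡⟨ sym (∑-distrib-+ (𝟙 ∘ at0) (count ∘ atSuc)) ⟩
  ∑[ i < f ] count (λ x → p x ∧ does (ℓ x ≟ᶠ i)) ∎
  where
  open ≡-Reasoning
  at0 : Fin f → Bool
  at0 i = p zero ∧ does (ℓ zero ≟ᶠ i)
  atSuc : Fin f → Fin k → Bool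
  atSuc i x = p (suc x) ∧ does (ℓ (suc x) ≟ᶠ i)

iter-fixed : ∀ {A : Set} {f : A → A} {x} → f x ≡ x → ∀ k → iter f k x ≡ x
iter-fixed         fx≡x zero    = refl
iter-fixed {f = f} fx≡x (suc k) = trans (cong f (iter-fixed fx≡x k)) fx≡x

if-does-true : ∀ {P : Set} (a : Bool) (P? : Dec P) → (if a then does P? else false) ≡ true → a ≡ true × P
if-does-true true  (yes p) _ = refl , p
if-does-true true  (no _)  ()
if-does-true false _       ()

d*𝟙[d≡3]≡3*𝟙[d≡3] : ∀ d (d≟3 : Dec (d ≡ 3)) → d * 𝟙 (does d≟3) ≡ 3 * 𝟙 (does d≟3)
d*𝟙[d≡3]≡3*𝟙[d≡3] d (yes refl) = refl
d*𝟙[d≡3]≡3*𝟙[d≡3] d (no _)     = *-zeroʳ d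

-- 3 × the final charge of a d-vertex with t neighbours of degree 3 is 3(d − 4) + 3[d = 3] − t.
final-charge-nonneg : ∀ d t → 3 ≤ d → t ≤ d → (d ≡ 3 → t ≡ 0) → (d ≡ 4 → t ≡ 0) → (d ≡ 5 → t < 4) →
                      12 + t ≤ 3 * d + 3 * 𝟙 (does (d ≟ 3))
final-charge-nonneg 1 _ (s≤s ()) _ _ _ _
final-charge-nonneg 2 _ (s≤s (s≤s ())) _ _ _ _
final-charge-nonneg 3 t _ _ t≡0 _ _ = ≤-reflexive (cong (12 +_) (t≡0 refl))
final-charge-nonneg 4 t _ _ _ t≡0 _ = ≤-reflexive (cong (12 +_) (t≡0 refl))
final-charge-nonneg 5 t _ _ _ _ t<4 = +-monoʳ-≤ 12 (≤-pred (t<4 refl))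
final-charge-nonneg d@(suc (suc (suc (suc (suc (suc _)))))) t _ t≤d _ _ _ = begin
  12 + t      ≤⟨ +-mono-≤ (*-monoʳ-≤ 2 6≤d) t≤d ⟩
  2 * d + d   ≡⟨ +-comm (2 * d) d ⟩
  3 * d       ≤⟨ m≤m+n (3 * d) _ ⟩
  3 * d + 0   ∎
  where
  open ≤-Reasoning
  6≤d : 6 ≤ d
  6≤d = s≤s (s≤s (s≤s (s≤s (s≤s (s≤s z≤n)))))

LightEdge : Graph → Set
LightEdge G = ∃ λ u → ∃ λ v → Adj G u v × deg G u ≡ 3 × deg G v ≤ 4

Crowded5Vertex : Graph → Set
Crowded5Vertex G = ∃ λ v → deg G v ≡ 5 × 4 ≤ deg3Neighbours G v

lightEdge? : ∀ G → Dec (LightEdge G)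
lightEdge? G = any? λ u → any? λ v → (adj G u v ≟ᴮ true) ×-dec (deg G u ≟ 3) ×-dec (deg G v ≤? 4)

crowded5Vertex? : ∀ G → Dec (Crowded5Vertex G)
crowded5Vertex? G = any? λ v → (deg G v ≟ 5) ×-dec (4 ≤? deg3Neighbours G v)

module _ {G : Graph} where

  Adj-sym : ∀ {u v} → Adj G u v → Adj G v u
  Adj-sym {u} {v} uv = trans (Graph.sym G v u) uv

  Adj⇒≢ : ∀ {u v} → Adj G u v → u ≢ v
  Adj⇒≢ {u} uu refl with trans (sym uu) (irrefl G u)
  ... | ()

  triangle : ∀ {u v w} → Adj G u v → Adj G v w → Adj G w u → Cycle G 3
  triangle {u} {v} {w} uv vw wu = record
    { m = 2 ; len≡ = refl ; len≥3 = ≤-refl ; c = c ; inj = inj ; consec = consec ; closing = wu }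
    where
    c : Fin 3 → Fin (n G)
    c 0F = u
    c 1F = v
    c 2F = w
    inj : ∀ i j → c i ≡ c j → i ≡ j
    inj 0F 0F _ = refl
    inj 1F 1F _ = refl
    inj 2F 2F _ = refl
    inj 0F 1F e = ⊥-elim (Adj⇒≢ uv e)
    inj 1F 0F e = ⊥-elim (Adj⇒≢ uv (sym e))
    inj 1F 2F e = ⊥-elim (Adj⇒≢ vw e)
    inj 2F 1F e = ⊥-elim (Adj⇒≢ vw (sym e))
    inj 2F 0F e = ⊥-elim (Adj⇒≢ wu e)
    inj 0F 2F e = ⊥-elim (Adj⇒≢ wu (sym e))
    consec : ∀ (i : Fin 2) → Adj G (c (inject₁ i)) (c (suc i))
    consec 0F = uv
    consec 1F = vw

  girth≥4⇒no-triangle : girth≥ G 4 → ∀ {u v w} → Adj G u v → Adj G v w → Adj G w u → ⊥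
  girth≥4⇒no-triangle g≥4 uv vw wu = 1+n≰n (g≥4 3 (triangle uv vw wu))

  ∑-count-neighbours : (q : Fin (n G) → Bool) →
    ∑[ v < n G ] count (λ u → if adj G v u then q u else false) ≡ ∑[ u < n G ] (deg G u * 𝟙 (q u))
  ∑-count-neighbours q = begin
    ∑[ v < n G ] count (λ u → if adj G v u then q u else false)
      ≡⟨ sum-cong-≗ (λ v → trans (count≡∑ (λ u → if adj G v u then q u else false))
                                 (sum-cong-≗ (λ u → 𝟙-if (adj G v u) (q u)))) ⟩
    ∑[ v < n G ] ∑[ u < n G ] (𝟙 (adj G v u) * 𝟙 (q u))
      ≡⟨ ∑-comm (λ v u → 𝟙 (adj G v u) * 𝟙 (q u)) ⟩
    ∑[ u < n G ] ∑[ v < n G ] (𝟙 (adj G v u) * 𝟙 (q u))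
      ≡⟨ sum-cong-≗ (λ u → sym (*-distribʳ-sum (𝟙 (q u)) (λ v → 𝟙 (adj G v u)))) ⟩
    ∑[ u < n G ] (∑[ v < n G ] 𝟙 (adj G v u) * 𝟙 (q u))
      ≡⟨ sum-cong-≗ (λ u → cong (_* 𝟙 (q u)) (sym (trans (count≡∑ (adj G u))
                                                          (sum-cong-≗ (λ v → cong 𝟙 (Graph.sym G u v)))))) ⟩
    ∑[ u < n G ] (deg G u * 𝟙 (q u)) ∎
    where
    open ≡-Reasoning
    𝟙-if : ∀ a b → 𝟙 (if a then b else false) ≡ 𝟙 a * 𝟙 b
    𝟙-if true  b = sym (+-identityʳ (𝟙 b))
    𝟙-if false b = refl

  module _ (R : RotationSystem G) where

    rot-≢ : ∀ {v u} → 2 ≤ deg G v → Adj G v u → rot R v u ≢ u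
    rot-≢ {v} {u} 2≤deg vu fixed = 1+n≰n (≤-trans 2≤deg (count≤1 {p = adj G v} u only-u))
      where
      only-u : ∀ w → Adj G v w → w ≡ u
      only-u w vw with cyclic R v u w vu vw
      ... | k , u↝w = trans (sym u↝w) (iter-fixed fixed k)

    module _ {f : ℕ} (F : Faces G R f) where
      open Faces F

      faceDarts : Fin f → Fin (n G) → ℕ
      faceDarts i u = count (λ v → adj G u v ∧ does (face u v ≟ᶠ i))

      dartCount≡∑faceDarts : dartCount G ≡ ∑[ i < f ] ∑[ u < n G ] faceDarts i u
      dartCount≡∑faceDarts = begin
        sumFin (deg G)                                ≡⟨ sumFin≡∑ (deg G) ⟩
        ∑[ u < n G ] count (adj G u)                  ≡⟨ sum-cong-≗ (λ u → count-fibres (adj G u) (face u)) ⟩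
        ∑[ u < n G ] ∑[ i < f ] faceDarts i u         ≡⟨ ∑-comm (λ u i → faceDarts i u) ⟩
        ∑[ i < f ] ∑[ u < n G ] faceDarts i u         ∎
        where open ≡-Reasoning

      face-step : ∀ {u v i} → Adj G u v → face u v ≡ i → Adj G v (rot R v u) × face v (rot R v u) ≡ i
      face-step {u} {v} uv refl = vw , sym (→orbit u v v _ uv vw (1 , refl))
        where
        vw : Adj G v (rot R v u)
        vw = closed R v u (Adj-sym uv)

      dart-in-face : ∀ {u v i} → Adj G u v → face u v ≡ i → 1 ≤ faceDarts i u
      dart-in-face {u} {v} {i} uv uv∈i =
        1≤count {p = λ w → adj G u w ∧ does (face u w ≟ᶠ i)} (cong₂ _∧_ uv (dec-true (face u v ≟ᶠ i) uv∈i))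

      4≤∑faceDarts : minDegree≥ G 3 → girth≥ G 4 → ∀ i → 4 ≤ ∑[ u < n G ] faceDarts i u
      4≤∑faceDarts δ≥3 g≥4 i with surj i
      ... | u , v , uv , uv∈i = length≤∑ {xs = u ∷ v ∷ w ∷ x ∷ []} distinct
              (dart-in-face uv uv∈i ∷ dart-in-face vw vw∈i ∷ dart-in-face wx wx∈i ∷ dart-in-face xy xy∈i ∷ [])
        where
        w x y : Fin (n G)
        w = rot R v u
        x = rot R w v
        y = rot R x w
        vw : Adj G v w
        vw = proj₁ (face-step uv uv∈i)
        vw∈i : face v w ≡ i
        vw∈i = proj₂ (face-step uv uv∈i)
        wx : Adj G w x
        wx = proj₁ (face-step vw vw∈i)
        wx∈i : face w x ≡ i
        wx∈i = proj₂ (face-step vw vw∈i)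
        xy : Adj G x y
        xy = proj₁ (face-step wx wx∈i)
        xy∈i : face x y ≡ i
        xy∈i = proj₂ (face-step wx wx∈i)
        rot-moves : ∀ {a b} → Adj G a b → rot R b a ≢ a
        rot-moves ab = rot-≢ (<⇒≤ (δ≥3 _)) (Adj-sym ab)
        u≢x : u ≢ x
        u≢x u≡x = girth≥4⇒no-triangle g≥4 uv vw (subst (Adj G w) (sym u≡x) wx)
        distinct : Unique (u ∷ v ∷ w ∷ x ∷ [])
        distinct = (Adj⇒≢ uv ∷ ≢-sym (rot-moves uv) ∷ u≢x ∷ [])
                 ∷ (Adj⇒≢ vw ∷ ≢-sym (rot-moves vw) ∷ [])
                 ∷ (Adj⇒≢ wx ∷ [])
                 ∷ [] ∷ []

      faces*4≤dartCount : minDegree≥ G 3 → girth≥ G 4 → f * 4 ≤ dartCount G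
      faces*4≤dartCount δ≥3 g≥4 = begin
        f * 4                                  ≡⟨ sym (∑-const f 4) ⟩
        ∑[ i < f ] 4                           ≤⟨ ∑-mono-≤ (4≤∑faceDarts δ≥3 g≥4) ⟩
        ∑[ i < f ] ∑[ u < n G ] faceDarts i u  ≡⟨ sym dartCount≡∑faceDarts ⟩
        dartCount G                            ∎
        where open ≤-Reasoning

      dartCount+8≤n*4 : minDegree≥ G 3 → girth≥ G 4 → 2 * (n G + f) ≡ dartCount G + 4 →
                        dartCount G + 8 ≤ n G * 4
      dartCount+8≤n*4 δ≥3 g≥4 euler = +-cancelˡ-≤ D (D + 8) (n G * 4) (begin
        D + (D + 8)           ≡⟨ double D ⟩
        2 * (D + 4)           ≡⟨ cong (2 *_) (sym euler) ⟩
        2 * (2 * (n G + f))   ≡⟨ quadruple (n G) f ⟩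
        n G * 4 + f * 4       ≤⟨ +-monoʳ-≤ (n G * 4) (faces*4≤dartCount δ≥3 g≥4) ⟩
        n G * 4 + D           ≡⟨ +-comm (n G * 4) D ⟩
        D + n G * 4           ∎)
        where
        open ≤-Reasoning
        D : ℕ
        D = dartCount G
        double : ∀ m → m + (m + 8) ≡ 2 * (m + 4)
        double = solve-∀
        quadruple : ∀ a b → 2 * (2 * (a + b)) ≡ a * 4 + b * 4
        quadruple = solve-∀

  deg3-neighbour : ∀ {v u} → (if adj G v u then does (deg G u ≟ 3) else false) ≡ true → Adj G v u × deg G u ≡ 3
  deg3-neighbour {v} {u} = if-does-true (adj G v u) (deg G u ≟ 3)

  deg3Neighbours≤deg : ∀ v → deg3Neighbours G v ≤ deg G v
  deg3Neighbours≤deg v = count-mono {n G} (λ u → proj₁ ∘ deg3-neighbour {v} {u})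

  deg3Neighbours≡0 : ∀ {v} → (∀ {u} → Adj G v u → deg G u ≢ 3) → deg3Neighbours G v ≡ 0
  deg3Neighbours≡0 {v} no-deg3 = count-none {n G} (λ u → uncurry no-deg3 ∘ deg3-neighbour {v} {u})

  ∑deg3Neighbours≡3*∑𝟙[deg≡3] :
    ∑[ v < n G ] deg3Neighbours G v ≡ 3 * ∑[ v < n G ] 𝟙 (does (deg G v ≟ 3))
  ∑deg3Neighbours≡3*∑𝟙[deg≡3] = begin
    ∑[ v < n G ] deg3Neighbours G v             ≡⟨ ∑-count-neighbours (λ u → does (deg G u ≟ 3)) ⟩
    ∑[ u < n G ] (deg G u * 𝟙[deg≡3] u)         ≡⟨ sum-cong-≗ (λ u → d*𝟙[d≡3]≡3*𝟙[d≡3] (deg G u) (deg G u ≟ 3)) ⟩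
    ∑[ u < n G ] (3 * 𝟙[deg≡3] u)               ≡⟨ sym (*-distribˡ-sum 3 𝟙[deg≡3]) ⟩
    3 * ∑[ u < n G ] 𝟙[deg≡3] u                 ∎
    where
    open ≡-Reasoning
    𝟙[deg≡3] : Fin (n G) → ℕ
    𝟙[deg≡3] u = 𝟙 (does (deg G u ≟ 3))

  final-charge-nonneg-at : minDegree≥ G 3 → ¬ LightEdge G → ¬ Crowded5Vertex G → ∀ v →
    12 + deg3Neighbours G v ≤ 3 * deg G v + 3 * 𝟙 (does (deg G v ≟ 3))
  final-charge-nonneg-at δ≥3 ¬light ¬crowded v =
    final-charge-nonneg (deg G v) (deg3Neighbours G v) (δ≥3 v) (deg3Neighbours≤deg v)
      (λ dv≡3 → deg3Neighbours≡0 (λ vu du≡3 → ¬light (v , _ , vu , dv≡3 , ≤-trans (≤-reflexive du≡3) (n≤1+n 3))))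
      (λ dv≡4 → deg3Neighbours≡0 (λ vu du≡3 → ¬light (_ , v , Adj-sym vu , du≡3 , ≤-reflexive dv≡4)))
      (λ dv≡5 → ≰⇒> (λ 4≤t → ¬crowded (v , dv≡5 , 4≤t)))

  n*4≤dartCount : minDegree≥ G 3 → ¬ LightEdge G → ¬ Crowded5Vertex G → n G * 4 ≤ dartCount G
  n*4≤dartCount δ≥3 ¬light ¬crowded = *-cancelˡ-≤ 3 (+-cancelʳ-≤ (3 * E) (3 * (n G * 4)) (3 * D) (begin
    3 * (n G * 4) + 3 * E                           ≡⟨ cong₂ _+_ initial (sym ∑deg3Neighbours≡3*∑𝟙[deg≡3]) ⟩
    ∑[ v < n G ] 12 + ∑[ v < n G ] t v              ≡⟨ sym (∑-distrib-+ (λ _ → 12) t) ⟩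
    ∑[ v < n G ] (12 + t v)                         ≤⟨ ∑-mono-≤ (final-charge-nonneg-at δ≥3 ¬light ¬crowded) ⟩
    ∑[ v < n G ] (3 * deg G v + 3 * e v)            ≡⟨ ∑-distrib-+ (λ v → 3 * deg G v) (λ v → 3 * e v) ⟩
    ∑[ v < n G ] (3 * deg G v) + ∑[ v < n G ] (3 * e v)
                                                    ≡⟨ cong₂ _+_ (trans (sym (*-distribˡ-sum 3 (deg G))) (cong (3 *_) (sym (sumFin≡∑ (deg G)))))
                                                                 (sym (*-distribˡ-sum 3 e)) ⟩
    3 * D + 3 * E                                   ∎))
    where
    open ≤-Reasoning
    t e : Fin (n G) → ℕ
    t = deg3Neighbours G
    e v = 𝟙 (does (deg G v ≟ 3))
    D E : ℕ
    D = dartCount G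
    E = ∑[ v < n G ] e v
    initial : 3 * (n G * 4) ≡ ∑[ v < n G ] 12
    initial = trans (cong (3 *_) (sym (∑-const (n G) 4))) (*-distribˡ-sum {n G} 3 (λ _ → 4))

unavoidable : ∀ {G} → Connected G → Planar G → minDegree≥ G 3 → girth≥ G 4 →
              ¬ LightEdge G → ¬ Crowded5Vertex G → ⊥
unavoidable {G} (n>0 , _) (inj₁ D≡0) δ≥3 _ ¬light ¬crowded = 1+n≰n (begin
  1           ≤⟨ n>0 ⟩
  n G         ≤⟨ m≤m*n (n G) 4 ⟩
  n G * 4     ≤⟨ n*4≤dartCount {G} δ≥3 ¬light ¬crowded ⟩
  dartCount G ≡⟨ D≡0 ⟩
  0           ∎)
  where open ≤-Reasoning
unavoidable {G} _ (inj₂ (R , f , F , euler)) δ≥3 g≥4 ¬light ¬crowded = m+1+n≰m (dartCount G) (begin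
  dartCount G + 8 ≤⟨ dartCount+8≤n*4 R F δ≥3 g≥4 euler ⟩
  n G * 4         ≤⟨ n*4≤dartCount {G} δ≥3 ¬light ¬crowded ⟩
  dartCount G     ∎)
  where open ≤-Reasoning

mainTheorem6 : (G : Graph) → Connected G → Planar G → minDegree≥ G 3 → girth≥ G 4 →
    (∃ λ u → ∃ λ v → Adj G u v × deg G u ≡ 3 × deg G v ≤ 4)
    ⊎ (∃ λ v → deg G v ≡ 5 × 4 ≤ deg3Neighbours G v)
mainTheorem6 G connected planar δ≥3 g≥4 with lightEdge? G | crowded5Vertex? G
... | yes light | _           = inj₁ light
... | no _      | yes crowded = inj₂ crowded
... | no ¬light | no ¬crowded = ⊥-elim (unavoidable connected planar δ≥3 g≥4 ¬light ¬crowded)
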